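{- Let $r\geq1$, let $G$ be a graph of maximum degree at most $r+1$ and let $A_0\subseteq V(G)$. Then $A_0$ percolates under the $r$-neighbour process in $G$ if and only if (i) $A_0$ contains every vertex of $G$ of degree less than $r$, and (ii) every connected component of the graph $G\setminus A_0$ (the subgraph of $G$ induced by $V(G)\setminus A_0$) is a tree containing at most one vertex whose degree in $G$ equals $r$.
   Context: For a graph $G$ and an integer $r\ge 1$, the $r$-neighbour bootstrap process starts from a set $A_0\subseteq V(G)$ of infected vertices and, for $t\ge1$, sets $A_t=A_{t-1}\cup\{v\in V(G): |N_G(v)\cap A_{t-1}|\ge r\}$. The set $A_0$ percolates if $\bigcup_t A_t=V(G)$. -}

module Defs where

open import Data.Nat using (ℕ; zero; suc; _≤_; _≤ᵇ_)
open import Data.Bool using (Bool; true; false; if_then_else_; _∨_)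
open import Data.Fin using (Fin)
open import Data.List using (List; []; _∷_; map; allFin; length; _++_; [_])
open import Data.Nat.ListAction using (sum)
open import Data.List.Relation.Unary.All using (All)
open import Data.List.Relation.Unary.Unique.Propositional using (Unique)
open import Data.List.Relation.Unary.Linked using (Linked)
open import Data.Empty using (⊥)
open import Data.Product using (Σ; _×_; ∃)
open import Relation.Binary.PropositionalEquality using (_≡_)
open import Relation.Binary.Construct.Closure.ReflexiveTransitive using (Star)

record Graph (n : ℕ) : Set where
  field
    adj    : Fin n → Fin n → Bool
    sym    : ∀ u v → adj u v ≡ adj v u
    irrefl : ∀ v → adj v v ≡ false
open Graph public

VSet : ℕ → Set
VSet n = Fin n → Bool

nbrsIn : ∀ {n} → Graph n → VSet n → Fin n → ℕ
nbrsIn {n} G A v =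
  sum (map (λ u → if adj G v u then (if A u then 1 else 0) else 0) (allFin n))

deg : ∀ {n} → Graph n → Fin n → ℕ
deg G v = nbrsIn G (λ _ → true) v

step : ∀ {n} → Graph n → ℕ → VSet n → VSet n
step G r A v = A v ∨ (r ≤ᵇ nbrsIn G A v)

infected : ∀ {n} → Graph n → ℕ → VSet n → ℕ → VSet n
infected G r A₀ zero    = A₀
infected G r A₀ (suc t) = step G r (infected G r A₀ t)

-- A₀ percolates: ⋃_t A_t = V(G).  (The A_t are increasing and V(G) is finite,
-- so this is equivalent to some single A_t being all of V(G).)
Percolates : ∀ {n} → Graph n → ℕ → VSet n → Set
Percolates G r A₀ = ∀ v → Σ ℕ (λ t → infected G r A₀ t v ≡ true)

EdgeOutside : ∀ {n} → Graph n → VSet n → Fin n → Fin n → Set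
EdgeOutside G A₀ x y = A₀ x ≡ false × A₀ y ≡ false × adj G x y ≡ true

InComponent : ∀ {n} → Graph n → VSet n → Fin n → Fin n → Set
InComponent G A₀ v u = A₀ u ≡ false × Star (EdgeOutside G A₀) v u

IsCycle : ∀ {n} → Graph n → List (Fin n) → Set
IsCycle G []       = ⊥
IsCycle G (x ∷ xs) =
  3 ≤ length (x ∷ xs) × Unique (x ∷ xs) ×
  Linked (λ a b → adj G a b ≡ true) ((x ∷ xs) ++ [ x ])

-- the component of v in G ∖ A₀ (v ∉ A₀) is a tree: it is connected by
-- construction, and it contains no cycle of G (all edges of G between its
-- vertices are edges of G ∖ A₀)
ComponentIsTree : ∀ {n} → Graph n → VSet n → Fin n → Set
ComponentIsTree {n} G A₀ v =
  (cyc : List (Fin n)) → IsCycle G cyc → All (InComponent G A₀ v) cyc → ⊥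

AtMostOneDegR : ∀ {n} → Graph n → ℕ → VSet n → Fin n → Set
AtMostOneDegR G r A₀ v =
  ∀ u w → InComponent G A₀ v u → InComponent G A₀ v w →
  deg G u ≡ r → deg G w ≡ r → u ≡ w

-- Every degree is at most r + 1, so a vertex keeps fewer than r infected
-- neighbours as long as two of its neighbours stay uninfected (one suffices if
-- its degree is r, none if it is below r).  Hence a vertex of degree < r, a
-- cycle, or a path joining two vertices of degree r that avoids A₀ is never
-- infected.  Conversely, if v is still uninfected at a late time, follow
-- uninfected neighbours backwards in time: a vertex of degree r + 1 always
-- offers an uninfected neighbour other than the one we came from, and since the
-- component is a tree the walk never revisits a vertex, so within n steps it
-- stops at a vertex of degree r.  Restarting from that vertex produces a second
-- vertex of degree r in the same component.
module Submission where

open import Defs hiding (sym)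
open import Data.Nat using (ℕ; zero; suc; _≤_; _<_; _+_; _*_; z≤n; s≤s; _≤ᵇ_)
open import Data.Nat.Properties
open import Data.Fin using (Fin; zero; suc; punchIn)
open import Data.Fin.Properties using (¬∀⟶∃¬; punchInᵢ≢i; punchIn-punchOut; injective⇒≤)
  renaming (_≟_ to _≟ᶠ_)
open import Data.Bool using (true; false; not; if_then_else_; T)
open import Data.Bool.Properties using (not-injective)
open import Data.Sum using (_⊎_; inj₁; inj₂)
open import Data.Product using (_×_; _,_; Σ; ∃; proj₁; proj₂)
open import Data.Empty using (⊥; ⊥-elim)
open import Data.List using (List; []; _∷_; _++_; [_]; _∷ʳ_; length; lookup; tabulate)
open import Data.List.Properties using (map-tabulate; length-++; ++-assoc; ++-identityʳ)
open import Data.List.Relation.Unary.All as All using (All; []; _∷_)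
open import Data.List.Relation.Unary.Any using (here; there)
open import Data.List.Relation.Unary.All.Properties using (¬Any⇒All¬)
open import Data.List.Relation.Unary.Linked using (Linked; []; [-]; _∷_)
open import Data.List.Relation.Unary.Unique.Propositional using (Unique; []; _∷_)
open import Data.List.Relation.Unary.Unique.Propositional.Properties using (Unique[x∷xs]⇒x∉xs)
import Data.List.Relation.Unary.Unique.Propositional.Properties as Unique
open import Data.List.Membership.Propositional using (_∈_; _∉_)
open import Data.List.Membership.Propositional.Properties using (∈-++⁺ʳ; ∈-++⁻; ∈-lookup)
open import Relation.Binary.Construct.Closure.ReflexiveTransitive using (Star; ε; _◅_; _◅◅_; reverse)
open import Data.Unit using (⊤; tt)
import Data.Nat.ListAction as List
open import Data.Vec.Functional using (Vector; removeAt)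
open import Algebra.Properties.CommutativeMonoid.Sum +-0-commutativeMonoid
  using (sum; ∑-distrib-+; sum-remove; sum-cong-≗; sum-replicate-zero)
open import Function using (_∘_; case_of_)
open import Relation.Binary.PropositionalEquality hiding ([_])
open import Relation.Nullary using (¬_; yes; no)
open import Function.Bundles using (_⇔_; mk⇔)

sum-tabulate : ∀ {n} (g : Vector ℕ n) → List.sum (tabulate g) ≡ sum g
sum-tabulate {zero}  g = refl
sum-tabulate {suc n} g = cong (g zero +_) (sum-tabulate (g ∘ suc))

entry≤sum : ∀ {n} (g : Vector ℕ n) i → g i ≤ sum g
entry≤sum {suc n} g i = ≤-trans (m≤m+n (g i) _) (≤-reflexive (sym (sum-remove g)))

two-entries≤sum : ∀ {n} (g : Vector ℕ n) {i j} → i ≢ j → g i + g j ≤ sum g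
two-entries≤sum {suc n} g {i} {j} i≢j = begin
  g i + g j                                ≡⟨ cong (λ k → g i + g k) (sym (punchIn-punchOut i≢j)) ⟩
  g i + removeAt g i _                     ≤⟨ +-monoʳ-≤ (g i) (entry≤sum (removeAt g i) _) ⟩
  g i + sum (removeAt g i)                 ≡⟨ sym (sum-remove g) ⟩
  sum g                                    ∎
  where open ≤-Reasoning

1≤sum⇒1≤entry : ∀ {n} (g : Vector ℕ n) → 1 ≤ sum g → ∃ λ i → 1 ≤ g i
1≤sum⇒1≤entry {n} g 1≤∑ with ¬∀⟶∃¬ n (λ i → g i ≡ 0) (λ i → g i ≟ 0) not-all-zero
  where
  not-all-zero : ¬ (∀ i → g i ≡ 0)
  not-all-zero all-zero = <⇒≢ 1≤∑ (sym (trans (sum-cong-≗ all-zero) (sum-replicate-zero n)))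
... | i , gi≢0 = i , n≢0⇒n>0 gi≢0

2≤sum⇒1≤entry-≢ : ∀ {n} (g : Vector ℕ n) p → g p ≤ 1 → 2 ≤ sum g → ∃ λ i → i ≢ p × 1 ≤ g i
2≤sum⇒1≤entry-≢ {suc n} g p gp≤1 2≤∑ with 1≤sum⇒1≤entry (removeAt g p) 1≤rest
  where
  1≤rest : 1 ≤ sum (removeAt g p)
  1≤rest = +-cancelˡ-≤ 1 1 _ (≤-trans 2≤∑ (≤-trans (≤-reflexive (sum-remove g)) (+-monoˡ-≤ _ gp≤1)))
... | j , 1≤gj = punchIn p j , punchInᵢ≢i p j , 1≤gj

module _ {A : Set} where

  Linked-∷ʳ : ∀ {R : A → A → Set} xs {a b} → Linked R (xs ∷ʳ a) → R a b → Linked R (xs ∷ʳ a ∷ʳ b)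
  Linked-∷ʳ []           _             Rab = Rab ∷ [-]
  Linked-∷ʳ (x ∷ [])     (Rxa ∷ [-])   Rab = Rxa ∷ Rab ∷ [-]
  Linked-∷ʳ (x ∷ y ∷ xs) (Rxy ∷ lnkd)  Rab = Rxy ∷ Linked-∷ʳ (y ∷ xs) lnkd Rab

  ∈-rotate : ∀ (x : A) xs {y} → y ∈ xs ∷ʳ x → y ∈ x ∷ xs
  ∈-rotate x xs y∈ with ∈-++⁻ xs y∈
  ... | inj₁ y∈xs       = there y∈xs
  ... | inj₂ (here y≡x) = here y≡x

  prefixThrough : ∀ {y : A} {xs} → y ∈ xs → List A
  prefixThrough (here {x = x} _)  = [ x ]
  prefixThrough (there {x = x} m) = x ∷ prefixThrough m

  1≤length-prefixThrough : ∀ {y : A} {xs} (m : y ∈ xs) → 1 ≤ length (prefixThrough m)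
  1≤length-prefixThrough (here _)  = s≤s z≤n
  1≤length-prefixThrough (there _) = s≤s z≤n

  All-prefixThrough : ∀ {P : A → Set} {y xs} → All P xs → (m : y ∈ xs) → All P (prefixThrough m)
  All-prefixThrough (Px ∷ _)  (here _)  = Px ∷ []
  All-prefixThrough (Px ∷ Ps) (there m) = Px ∷ All-prefixThrough Ps m

  Unique-prefixThrough : ∀ {y xs} → Unique xs → (m : y ∈ xs) → Unique (prefixThrough m)
  Unique-prefixThrough _           (here _)  = [] ∷ []
  Unique-prefixThrough (x∉ ∷ uniq) (there m) = All-prefixThrough x∉ m ∷ Unique-prefixThrough uniq m

  Linked-prefixThrough : ∀ {R : A → A → Set} {y z xs} → Linked R xs → (m : y ∈ xs) → R y z →
    Linked R (prefixThrough m ++ [ z ])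
  Linked-prefixThrough _            (here refl)          Ryz = Ryz ∷ [-]
  Linked-prefixThrough (Rxy ∷ lnkd) (there (here refl))  Ryz = Rxy ∷ Linked-prefixThrough lnkd (here refl) Ryz
  Linked-prefixThrough (Rxy ∷ lnkd) (there (there m))    Ryz = Rxy ∷ Linked-prefixThrough lnkd (there m) Ryz

lookup-injective : ∀ {A : Set} {xs : List A} → Unique xs → ∀ {i j} → lookup xs i ≡ lookup xs j → i ≡ j
lookup-injective {xs = _ ∷ _} _          {zero}  {zero}  _  = refl
lookup-injective {xs = _ ∷ _} (x∉ ∷ _)   {zero}  {suc j} eq = ⊥-elim (All.lookup x∉ (∈-lookup j) eq)
lookup-injective {xs = _ ∷ _} (x∉ ∷ _)   {suc i} {zero}  eq = ⊥-elim (All.lookup x∉ (∈-lookup i) (sym eq))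
lookup-injective {xs = _ ∷ _} (_ ∷ uniq) {suc i} {suc j} eq = cong suc (lookup-injective uniq eq)

unique-length≤ : ∀ {n} {xs : List (Fin n)} → Unique xs → length xs ≤ n
unique-length≤ uniq = injective⇒≤ (lookup-injective uniq)

module _ {n} (G : Graph n) where

  Adjacent : Fin n → Fin n → Set
  Adjacent x y = adj G x y ≡ true

  adjacent-sym : ∀ {x y} → Adjacent x y → Adjacent y x
  adjacent-sym {x} {y} x~y = trans (Graph.sym G y x) x~y

  adjacent-≢ : ∀ {x y} → Adjacent x y → y ≢ x
  adjacent-≢ {x} x~x refl with trans (sym x~x) (irrefl G x)
  ... | ()

  TwoNeighboursIn : (Fin n → Set) → Fin n → Set
  TwoNeighboursIn S y = Σ (Fin n) λ a → Σ (Fin n) λ b → a ≢ b × S a × S b × Adjacent y a × Adjacent y b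

  TwoNeighboursIn-mono : ∀ {S T : Fin n → Set} → (∀ {a} → S a → T a) →
    ∀ {y} → TwoNeighboursIn S y → TwoNeighboursIn T y
  TwoNeighboursIn-mono S⊆T (a , b , a≢b , Sa , Sb , y~a , y~b) = a , b , a≢b , S⊆T Sa , S⊆T Sb , y~a , y~b

  nbrIndicator : VSet n → Fin n → Vector ℕ n
  nbrIndicator B x u = if adj G x u then (if B u then 1 else 0) else 0

  nbrsIn-sum : ∀ B x → nbrsIn G B x ≡ sum (nbrIndicator B x)
  nbrsIn-sum B x =
    trans (cong List.sum (map-tabulate (λ u → u) (nbrIndicator B x))) (sum-tabulate (nbrIndicator B x))

  deg-split : ∀ B x → deg G x ≡ nbrsIn G B x + nbrsIn G (not ∘ B) x
  deg-split B x = begin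
    deg G x                                           ≡⟨ nbrsIn-sum (λ _ → true) x ⟩
    sum (nbrIndicator (λ _ → true) x)                                  ≡⟨ sum-cong-≗ split ⟩
    sum (λ u → nbrIndicator B x u + nbrIndicator (not ∘ B) x u)   ≡⟨ ∑-distrib-+ (nbrIndicator B x) _ ⟩
    sum (nbrIndicator B x) + sum (nbrIndicator (not ∘ B) x)       ≡⟨ sym (cong₂ _+_ (nbrsIn-sum B x) (nbrsIn-sum (not ∘ B) x)) ⟩
    nbrsIn G B x + nbrsIn G (not ∘ B) x               ∎
    where
    open ≡-Reasoning
    split : ∀ u → nbrIndicator (λ _ → true) x u ≡ nbrIndicator B x u + nbrIndicator (not ∘ B) x u
    split u with adj G x u | B u
    ... | true  | true  = refl
    ... | true  | false = refl
    ... | false | _     = refl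

  nbrIndicator≤1 : ∀ B x u → nbrIndicator B x u ≤ 1
  nbrIndicator≤1 B x u with adj G x u | B u
  ... | true  | true  = ≤-refl
  ... | true  | false = z≤n
  ... | false | _     = z≤n

  nbrIndicator-pos : ∀ {B x u} → 1 ≤ nbrIndicator B x u → Adjacent x u × B u ≡ true
  nbrIndicator-pos {B} {x} {u} 1≤c with adj G x u | B u
  ... | true  | true  = refl , refl
  ... | true  | false = ⊥-elim (1+n≰n 1≤c)
  ... | false | _     = ⊥-elim (1+n≰n 1≤c)

  nbrIndicator-member : ∀ {B x u} → Adjacent x u → B u ≡ true → nbrIndicator B x u ≡ 1
  nbrIndicator-member x~u Bu rewrite x~u | Bu = refl

  neighbour⇒1≤nbrsIn : ∀ {B x a} → Adjacent x a → B a ≡ true → 1 ≤ nbrsIn G B x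
  neighbour⇒1≤nbrsIn {B} {x} {a} x~a Ba =
    subst₂ _≤_ (nbrIndicator-member {B} {x} x~a Ba) (sym (nbrsIn-sum B x))
      (entry≤sum (nbrIndicator B x) a)

  two-neighbours⇒2≤nbrsIn : ∀ {B x a b} → a ≢ b → Adjacent x a → B a ≡ true →
    Adjacent x b → B b ≡ true → 2 ≤ nbrsIn G B x
  two-neighbours⇒2≤nbrsIn {B} {x} a≢b x~a Ba x~b Bb =
    subst₂ _≤_ (cong₂ _+_ (nbrIndicator-member {B} {x} x~a Ba) (nbrIndicator-member {B} {x} x~b Bb))
      (sym (nbrsIn-sum B x))
      (two-entries≤sum (nbrIndicator B x) a≢b)

  1≤nbrsIn⇒neighbour : ∀ {B x} → 1 ≤ nbrsIn G B x → ∃ λ a → Adjacent x a × B a ≡ true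
  1≤nbrsIn⇒neighbour {B} {x} 1≤ with 1≤sum⇒1≤entry (nbrIndicator B x) (subst (1 ≤_) (nbrsIn-sum B x) 1≤)
  ... | a , 1≤c = a , nbrIndicator-pos {B} {x} 1≤c

  2≤nbrsIn⇒neighbour-≢ : ∀ {B x} → 2 ≤ nbrsIn G B x → ∀ p → ∃ λ a → a ≢ p × Adjacent x a × B a ≡ true
  2≤nbrsIn⇒neighbour-≢ {B} {x} 2≤ p
    with 2≤sum⇒1≤entry-≢ (nbrIndicator B x) p (nbrIndicator≤1 B x p) (subst (2 ≤_) (nbrsIn-sum B x) 2≤)
  ... | a , a≢p , 1≤c = a , a≢p , nbrIndicator-pos {B} {x} 1≤c

  nbrsIn≤deg : ∀ A x → nbrsIn G A x ≤ deg G x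
  nbrsIn≤deg A x = subst (nbrsIn G A x ≤_) (sym (deg-split A x)) (m≤m+n _ _)

  outside-neighbour⇒nbrsIn<deg : ∀ {A x a} → Adjacent x a → A a ≡ false → nbrsIn G A x < deg G x
  outside-neighbour⇒nbrsIn<deg {A} {x} x~a Aa≡false =
    subst (nbrsIn G A x <_) (sym (deg-split A x))
      (m<m+n _ (neighbour⇒1≤nbrsIn {not ∘ A} x~a (cong not Aa≡false)))

  two-outside-neighbours⇒2+nbrsIn≤deg : ∀ {A x a b} → a ≢ b →
    Adjacent x a → A a ≡ false → Adjacent x b → A b ≡ false → 2 + nbrsIn G A x ≤ deg G x
  two-outside-neighbours⇒2+nbrsIn≤deg {A} {x} a≢b x~a Aa x~b Ab =
    subst₂ _≤_ (+-comm (nbrsIn G A x) 2) (sym (deg-split A x))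
      (+-monoʳ-≤ (nbrsIn G A x) (two-neighbours⇒2≤nbrsIn {not ∘ A} a≢b x~a (cong not Aa) x~b (cong not Ab)))

  nbrsIn<deg⇒outside-neighbour : ∀ {A x} → nbrsIn G A x < deg G x → ∃ λ a → Adjacent x a × A a ≡ false
  nbrsIn<deg⇒outside-neighbour {A} {x} N<deg
    with 1≤nbrsIn⇒neighbour {not ∘ A} (+-cancelˡ-≤ (nbrsIn G A x) 1 _
           (subst₂ _≤_ (+-comm 1 _) (deg-split A x) N<deg))
  ... | a , x~a , notAa = a , x~a , not-injective notAa

  2+nbrsIn≤deg⇒outside-neighbour-≢ : ∀ {A x} → 2 + nbrsIn G A x ≤ deg G x →
    ∀ p → ∃ λ a → a ≢ p × Adjacent x a × A a ≡ false
  2+nbrsIn≤deg⇒outside-neighbour-≢ {A} {x} 2+N≤deg p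
    with 2≤nbrsIn⇒neighbour-≢ {not ∘ A} (+-cancelˡ-≤ (nbrsIn G A x) 2 _
           (subst₂ _≤_ (+-comm 2 _) (deg-split A x) 2+N≤deg)) p
  ... | a , a≢p , x~a , notAa = a , a≢p , x~a , not-injective notAa

  rotate-cycle : ∀ {x y ys} → IsCycle G (x ∷ y ∷ ys) → IsCycle G (y ∷ ys ∷ʳ x)
  rotate-cycle {x} {y} {ys} (3≤len , x∉ ∷ unique , x~y ∷ linked) =
    subst (3 ≤_) (cong suc (sym (trans (length-++ ys) (+-comm (length ys) 1)))) 3≤len ,
    Unique.++⁺ unique ([] ∷ []) (λ { (x∈ , here refl) → Unique[x∷xs]⇒x∉xs (x∉ ∷ unique) x∈ }) ,
    Linked-∷ʳ (y ∷ ys) linked x~y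

  cycle-second-vertex : ∀ {x y z zs} → IsCycle G (x ∷ y ∷ z ∷ zs) → TwoNeighboursIn (_∈ x ∷ y ∷ z ∷ zs) y
  cycle-second-vertex {x} {z = z} (_ , (_ ∷ x≢z ∷ _) ∷ _ , x~y ∷ y~z ∷ _) =
    x , z , x≢z , here refl , there (there (here refl)) , adjacent-sym x~y , y~z

  -- Rotating the cycle moves v one place towards the second position, where
  -- its two neighbours on the cycle are explicit.
  cycle-vertex-after-head : ∀ x ys zs {v} → IsCycle G (x ∷ ys ++ zs) → v ∈ ys →
    TwoNeighboursIn (_∈ x ∷ ys ++ zs) v
  cycle-vertex-after-head x (y ∷ ys) zs cyc (here refl) with ys ++ zs
  cycle-vertex-after-head x (y ∷ ys) zs (s≤s (s≤s ()) , _) (here refl) | []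
  ... | z ∷ zs′ = cycle-second-vertex cyc
  cycle-vertex-after-head x (y ∷ ys) zs cyc (there v∈ys) =
    TwoNeighboursIn-mono unrotate
      (cycle-vertex-after-head y ys (zs ++ [ x ])
        (subst (λ l → IsCycle G (y ∷ l)) (++-assoc ys zs [ x ]) (rotate-cycle cyc)) v∈ys)
    where
    unrotate : ∀ {a} → a ∈ y ∷ ys ++ zs ++ [ x ] → a ∈ x ∷ y ∷ ys ++ zs
    unrotate {a} = ∈-rotate x (y ∷ ys ++ zs) ∘ subst (a ∈_) (cong (y ∷_) (sym (++-assoc ys zs [ x ])))

  cycle-vertex-neighbours : ∀ {c v} → IsCycle G c → v ∈ c → TwoNeighboursIn (_∈ c) v
  cycle-vertex-neighbours {x ∷ xs} cyc (there v∈xs) =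
    subst (λ l → TwoNeighboursIn (_∈ x ∷ l) _) (++-identityʳ xs)
      (cycle-vertex-after-head x xs [] (subst (λ l → IsCycle G (x ∷ l)) (sym (++-identityʳ xs)) cyc) v∈xs)
  cycle-vertex-neighbours {x ∷ []} (s≤s () , _) (here refl)
  cycle-vertex-neighbours {x ∷ y ∷ ys} cyc (here refl) =
    TwoNeighboursIn-mono (∈-rotate x (y ∷ ys))
      (cycle-vertex-neighbours (rotate-cycle cyc) (there (∈-++⁺ʳ ys (here refl))))

module _ {n} (G : Graph n) (r : ℕ) where

  step-false : ∀ {A x} → step G r A x ≡ false → A x ≡ false × nbrsIn G A x < r
  step-false {A} {x} _ with A x | r ≤ᵇ nbrsIn G A x in r≤ᵇN
  step-false () | true | _
  step-false () | false | true
  ... | false | false = refl , ≰⇒> (λ r≤N → subst T r≤ᵇN (≤⇒≤ᵇ r≤N))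

  step-false⁺ : ∀ {A x} → A x ≡ false → nbrsIn G A x < r → step G r A x ≡ false
  step-false⁺ {A} {x} Ax N<r rewrite Ax with r ≤ᵇ nbrsIn G A x in r≤ᵇN
  ... | false = refl
  ... | true  = ⊥-elim (<⇒≱ N<r (≤ᵇ⇒≤ r _ (subst T (sym r≤ᵇN) _)))

  uninfected-pred : ∀ {A₀} t {x} → infected G r A₀ (suc t) x ≡ false → infected G r A₀ t x ≡ false
  uninfected-pred t = proj₁ ∘ step-false

  uninfected-earlier : ∀ {A₀} s k {x} → infected G r A₀ (k + s) x ≡ false → infected G r A₀ s x ≡ false
  uninfected-earlier s zero    = λ e → e
  uninfected-earlier s (suc k) = uninfected-earlier s k ∘ uninfected-pred (k + s)

  uninfected⇒∉A₀ : ∀ {A₀} t {x} → infected G r A₀ t x ≡ false → A₀ x ≡ false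
  uninfected⇒∉A₀ zero    = λ e → e
  uninfected⇒∉A₀ (suc t) = uninfected⇒∉A₀ t ∘ uninfected-pred t

  Shielded : (Fin n → Set) → Fin n → Set
  Shielded S y = ∀ A → (∀ z → S z → A z ≡ false) → nbrsIn G A y < r

  shielded-never-infected : ∀ {A₀} (S : Fin n → Set) → (∀ z → S z → A₀ z ≡ false) →
    (∀ z → S z → Shielded S z) → ∀ t z → S z → infected G r A₀ t z ≡ false
  shielded-never-infected S S∩A₀=∅ shielded zero    = S∩A₀=∅
  shielded-never-infected {A₀} S S∩A₀=∅ shielded (suc t) z Sz =
    step-false⁺ (IH z Sz) (shielded z Sz _ IH)
    where
    IH : ∀ z → S z → infected G r A₀ t z ≡ false
    IH = shielded-never-infected S S∩A₀=∅ shielded t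

  low-degree-shielded : ∀ {S y} → deg G y < r → Shielded S y
  low-degree-shielded {y = y} deg<r A _ = ≤-<-trans (nbrsIn≤deg G A y) deg<r

  one-neighbour-shielded : ∀ {S : Fin n → Set} {y a} → deg G y ≤ r → Adjacent G y a → S a → Shielded S y
  one-neighbour-shielded deg≤r y~a Sa A S∩A=∅ = <-≤-trans (outside-neighbour⇒nbrsIn<deg G y~a (S∩A=∅ _ Sa)) deg≤r

  two-neighbours-shielded : ∀ {S y} → deg G y ≤ suc r → TwoNeighboursIn G S y → Shielded S y
  two-neighbours-shielded deg≤1+r (a , b , a≢b , Sa , Sb , y~a , y~b) A S∩A=∅ =
    ≤-pred (≤-trans (two-outside-neighbours⇒2+nbrsIn≤deg G a≢b y~a (S∩A=∅ a Sa) y~b (S∩A=∅ b Sb)) deg≤1+r)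

  shielded-blocks-percolation : ∀ {A₀} → Percolates G r A₀ → (S : Fin n → Set) →
    (∀ z → S z → A₀ z ≡ false) → (∀ z → S z → Shielded S z) → ∀ z → ¬ S z
  shielded-blocks-percolation perc S S∩A₀=∅ shielded z Sz with perc z
  ... | t , infected-z with trans (sym infected-z) (shielded-never-infected S S∩A₀=∅ shielded t z Sz)
  ... | ()

module _ {n} (G : Graph n) (A₀ : VSet n) where

  edge-adjacent : ∀ {a b} → EdgeOutside G A₀ a b → Adjacent G a b
  edge-adjacent = proj₂ ∘ proj₂

  edge-sym : ∀ {a b} → EdgeOutside G A₀ a b → EdgeOutside G A₀ b a
  edge-sym (A₀a , A₀b , a~b) = A₀b , A₀a , adjacent-sym G a~b

  Walk : Fin n → Fin n → Set
  Walk = Star (EdgeOutside G A₀)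

  NonBacktracking : ∀ {a b} → Walk a b → Set
  NonBacktracking ε       = ⊤
  NonBacktracking (_ ◅ ε) = ⊤
  NonBacktracking (_◅_ {i = a} _ (_◅_ {j = c} e p)) = a ≢ c × NonBacktracking (e ◅ p)

  remove-backtracking : ∀ {a b} → Walk a b → Σ (Walk a b) NonBacktracking
  remove-backtracking ε = ε , tt
  remove-backtracking (e ◅ p) with remove-backtracking p
  ... | ε , _ = e ◅ ε , tt
  remove-backtracking {a} (e ◅ p) | _◅_ {j = c} e′ q , nb with a ≟ᶠ c
  ... | yes refl = q , NonBacktracking-tail e′ q nb
    where
    NonBacktracking-tail : ∀ {a b c} (e : EdgeOutside G A₀ a b) (q : Walk b c) → NonBacktracking (e ◅ q) → NonBacktracking q
    NonBacktracking-tail e ε       _        = tt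
    NonBacktracking-tail e (_ ◅ _) (_ , nb) = nb
  ... | no a≢c = e ◅ e′ ◅ q , a≢c , nb

  vertices : ∀ {a b} → Walk a b → List (Fin n)
  vertices {a} ε       = [ a ]
  vertices {a} (_ ◅ p) = a ∷ vertices p

  start∈vertices : ∀ {a b} (p : Walk a b) → a ∈ vertices p
  start∈vertices ε       = here refl
  start∈vertices (_ ◅ _) = here refl

  vertices-outside : ∀ {a b} → A₀ a ≡ false → (p : Walk a b) → All (λ y → A₀ y ≡ false) (vertices p)
  vertices-outside A₀a ε       = A₀a ∷ []
  vertices-outside A₀a (e ◅ p) = A₀a ∷ vertices-outside (proj₁ (proj₂ e)) p

  walk-vertex-neighbour : ∀ {a b c} (e : EdgeOutside G A₀ a b) (p : Walk b c) {y} → y ∈ vertices (e ◅ p) →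
    ∃ λ z → z ∈ vertices (e ◅ p) × Adjacent G y z
  walk-vertex-neighbour e p           (here refl)         = _ , there (start∈vertices p) , edge-adjacent e
  walk-vertex-neighbour {a} e ε       (there (here refl)) = a , here refl , adjacent-sym G (edge-adjacent e)
  walk-vertex-neighbour e (e′ ◅ p)    (there y∈)          with walk-vertex-neighbour e′ p y∈
  ... | z , z∈ , y~z = z , there z∈ , y~z

  endpoint-or-interior : ∀ {a b} (p : Walk a b) → NonBacktracking p → ∀ {y} → y ∈ vertices p →
    y ≡ a ⊎ y ≡ b ⊎ TwoNeighboursIn G (_∈ vertices p) y
  endpoint-or-interior ε       _ (here refl) = inj₁ refl
  endpoint-or-interior (_ ◅ _) _ (here refl) = inj₁ refl
  endpoint-or-interior (_ ◅ ε) _ (there (here refl)) = inj₂ (inj₁ refl)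
  endpoint-or-interior {a} (e ◅ e′ ◅ p) (a≢c , nb) (there y∈) with endpoint-or-interior (e′ ◅ p) nb y∈
  ... | inj₁ refl = inj₂ (inj₂ (a , _ , a≢c , here refl , there (there (start∈vertices p)) ,
                      adjacent-sym G (edge-adjacent e) , edge-adjacent e′))
  ... | inj₂ (inj₁ y≡b) = inj₂ (inj₁ y≡b)
  ... | inj₂ (inj₂ two) = inj₂ (inj₂ (TwoNeighboursIn-mono G there two))

module Forward {n} (G : Graph n) (r : ℕ) (A₀ : VSet n) (max-deg : ∀ v → deg G v ≤ suc r)
               (percolates : Percolates G r A₀) where

  low-degree-in-A₀ : ∀ v → deg G v < r → A₀ v ≡ true
  low-degree-in-A₀ v deg<r with A₀ v in A₀v
  ... | true  = refl
  ... | false = ⊥-elim (shielded-blocks-percolation G r percolates (_≡ v) (λ { _ refl → A₀v })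
                  (λ { _ refl → low-degree-shielded G r deg<r }) v refl)

  no-cycle-outside-A₀ : ∀ c → IsCycle G c → All (λ y → A₀ y ≡ false) c → ⊥
  no-cycle-outside-A₀ c@(x ∷ _) cyc outside =
    shielded-blocks-percolation G r percolates (_∈ c) (λ _ → All.lookup outside)
      (λ y y∈c → two-neighbours-shielded G r (max-deg y) (cycle-vertex-neighbours G cyc y∈c)) x (here refl)

  component-is-tree : ∀ v → ComponentIsTree G A₀ v
  component-is-tree v c cyc in-component = no-cycle-outside-A₀ c cyc (All.map proj₁ in-component)

  at-most-one-degree-r : ∀ v → AtMostOneDegR G r A₀ v
  at-most-one-degree-r v u w (A₀u , v⇝u) (_ , v⇝w) deg-u deg-w with u ≟ᶠ w
  ... | yes u≡w = u≡w
  ... | no u≢w with remove-backtracking G A₀ (reverse (edge-sym G A₀) v⇝u ◅◅ v⇝w)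
  ...   | ε , _ = ⊥-elim (u≢w refl)
  ...   | e ◅ p , nb =
    ⊥-elim (shielded-blocks-percolation G r percolates (_∈ vertices G A₀ (e ◅ p))
              (λ _ → All.lookup (vertices-outside G A₀ A₀u (e ◅ p))) shielded u (here refl))
    where
    shielded : ∀ y → y ∈ vertices G A₀ (e ◅ p) → Shielded G r (_∈ vertices G A₀ (e ◅ p)) y
    shielded y y∈ with endpoint-or-interior G A₀ (e ◅ p) nb y∈ | walk-vertex-neighbour G A₀ e p y∈
    ... | inj₁ refl        | z , z∈ , y~z = one-neighbour-shielded G r (≤-reflexive deg-u) y~z z∈
    ... | inj₂ (inj₁ refl) | z , z∈ , y~z = one-neighbour-shielded G r (≤-reflexive deg-w) y~z z∈
    ... | inj₂ (inj₂ two)  | _            = two-neighbours-shielded G r (max-deg y) two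

module Backward {n} (G : Graph n) (r : ℕ) (A₀ : VSet n) (max-deg : ∀ v → deg G v ≤ suc r)
  (low-degree-in-A₀ : ∀ v → deg G v < r → A₀ v ≡ true)
  (forest : ∀ v → A₀ v ≡ false → ComponentIsTree G A₀ v × AtMostOneDegR G r A₀ v) where

  open import Data.List.Membership.DecPropositional (_≟ᶠ_ {n}) using (_∈?_)

  Uninfected : ℕ → Fin n → Set
  Uninfected t x = infected G r A₀ t x ≡ false

  r≤deg : ∀ {x} → A₀ x ≡ false → r ≤ deg G x
  r≤deg {x} A₀x = ≮⇒≥ λ deg<r → case trans (sym (low-degree-in-A₀ x deg<r)) A₀x of λ ()

  degree-r-or-suc-r : ∀ {x} → A₀ x ≡ false → deg G x ≡ r ⊎ deg G x ≡ suc r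
  degree-r-or-suc-r {x} A₀x with m≤n⇒m<n∨m≡n (max-deg x)
  ... | inj₁ deg<1+r = inj₁ (≤-antisym (≤-pred deg<1+r) (r≤deg A₀x))
  ... | inj₂ deg≡1+r = inj₂ deg≡1+r

  uninfected-neighbour : ∀ t {x} → A₀ x ≡ false → Uninfected (suc t) x →
    ∃ λ y → Adjacent G x y × Uninfected t y
  uninfected-neighbour t A₀x x-uninf =
    nbrsIn<deg⇒outside-neighbour G (<-≤-trans (proj₂ (step-false G r x-uninf)) (r≤deg A₀x))

  uninfected-neighbour-≢ : ∀ t {x} → deg G x ≡ suc r → Uninfected (suc t) x →
    ∀ p → ∃ λ y → y ≢ p × Adjacent G x y × Uninfected t y
  uninfected-neighbour-≢ t {x} deg≡1+r x-uninf =
    2+nbrsIn≤deg⇒outside-neighbour-≢ G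
      (subst (2 + nbrsIn G (infected G r A₀ t) x ≤_) (sym deg≡1+r) (s≤s (proj₂ (step-false G r x-uninf))))

  module InComponentOf (v : Fin n) (A₀v : A₀ v ≡ false) where

    Component : Fin n → Set
    Component = InComponent G A₀ v

    component-step : ∀ {x y} → Component x → Adjacent G x y → A₀ y ≡ false → Component y
    component-step (A₀x , v⇝x) x~y A₀y = A₀y , v⇝x ◅◅ (A₀x , A₀y , x~y) ◅ ε

    no-cycle-back : ∀ {x p rest y} → Unique (x ∷ p ∷ rest) → Linked (Adjacent G) (x ∷ p ∷ rest) →
      All Component (x ∷ p ∷ rest) → Adjacent G x y → y ∉ rest
    no-cycle-back {x} {p} {rest} {y} uniq linked in-component x~y y∈rest =
      proj₁ (forest v A₀v) (prefixThrough y∈path)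
        (s≤s (s≤s (1≤length-prefixThrough y∈rest)) , Unique-prefixThrough uniq y∈path ,
         Linked-prefixThrough linked y∈path (adjacent-sym G x~y))
        (All-prefixThrough in-component y∈path)
      where
      y∈path : y ∈ x ∷ p ∷ rest
      y∈path = there (there y∈rest)

    -- The path x ∷ p ∷ rest is extended backwards in time, one round per step,
    -- until it reaches a vertex of degree r; the bound on its length forbids
    -- running out of fuel m.
    escape : ∀ s m {x p rest} → n < length (x ∷ p ∷ rest) + m →
      Unique (x ∷ p ∷ rest) → Linked (Adjacent G) (x ∷ p ∷ rest) → All Component (x ∷ p ∷ rest) →
      Uninfected (m + s) x → ∃ λ z → deg G z ≡ r × z ∉ p ∷ rest × Component z × Uninfected s z
    escape s m _ uniq _ (x-in ∷ _) x-uninf with degree-r-or-suc-r (proj₁ x-in)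
    ... | inj₁ deg≡r = _ , deg≡r , Unique[x∷xs]⇒x∉xs uniq , x-in , uninfected-earlier G r s m x-uninf
    escape s zero n<len uniq _ _ _ | inj₂ _ =
      ⊥-elim (<⇒≱ n<len (subst (_≤ n) (sym (+-identityʳ _)) (unique-length≤ uniq)))
    escape s (suc m) {x} {p} {rest} n<len uniq linked in-component@(x-in ∷ _) x-uninf | inj₂ deg≡1+r
      with uninfected-neighbour-≢ (m + s) deg≡1+r x-uninf p
    ... | y , y≢p , x~y , y-uninf with y ∈? (x ∷ p ∷ rest)
    ...   | yes (here y≡x)         = ⊥-elim (adjacent-≢ G x~y y≡x)
    ...   | yes (there (here y≡p)) = ⊥-elim (y≢p y≡p)
    ...   | yes (there (there y∈)) = ⊥-elim (no-cycle-back uniq linked in-component x~y y∈)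
    ...   | no y∉ with escape s m (subst (n <_) (+-suc _ m) n<len) (¬Any⇒All¬ _ y∉ ∷ uniq)
                         (adjacent-sym G x~y ∷ linked)
                         (component-step x-in x~y (uninfected⇒∉A₀ G r (m + s) y-uninf) ∷ in-component) y-uninf
    ...     | z , deg≡r , z∉ , z-in , z-uninf = z , deg≡r , z∉ ∘ there , z-in , z-uninf

    another-degree-r-vertex : ∀ s {x} → Component x → Uninfected (suc (n + s)) x →
      ∃ λ z → deg G z ≡ r × z ≢ x × Component z × Uninfected s z
    another-degree-r-vertex s x-in x-uninf
      with uninfected-neighbour (n + s) (proj₁ x-in) x-uninf
    ... | a , x~a , a-uninf
      with escape s n (<-trans (n<1+n n) (n<1+n (suc n))) ((adjacent-≢ G x~a ∷ []) ∷ [] ∷ [])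
             (adjacent-sym G x~a ∷ [-]) (component-step x-in x~a (uninfected⇒∉A₀ G r (n + s) a-uninf) ∷ x-in ∷ [])
             a-uninf
    ... | z , deg≡r , z∉[x] , z-in , z-uninf = z , deg≡r , z∉[x] ∘ here , z-in , z-uninf

    eventually-infected : Uninfected (2 * suc n) v → ⊥
    eventually-infected v-uninf with another-degree-r-vertex (suc (n + 0)) (A₀v , ε) v-uninf
    ... | u , deg-u , _ , u-in , u-uninf with another-degree-r-vertex 0 u-in u-uninf
    ... | w , deg-w , w≢u , w-in , _ = w≢u (proj₂ (forest v A₀v) w u w-in u-in deg-w deg-u)

  percolates : Percolates G r A₀
  percolates v with infected G r A₀ (2 * suc n) v in v-infected
  ... | true  = 2 * suc n , v-infected
  ... | false =
    ⊥-elim (InComponentOf.eventually-infected v (uninfected⇒∉A₀ G r (2 * suc n) v-infected) v-infected)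

lemma3p1 : ∀ {n} (G : Graph n) (r : ℕ) (A₀ : VSet n) → 1 ≤ r →
  (∀ v → deg G v ≤ suc r) →
  Percolates G r A₀ ⇔
    ((∀ v → deg G v < r → A₀ v ≡ true) ×
     (∀ v → A₀ v ≡ false → ComponentIsTree G A₀ v × AtMostOneDegR G r A₀ v))
lemma3p1 G r A₀ _ max-deg = mk⇔
  (λ percolates → let open Forward G r A₀ max-deg percolates in
     low-degree-in-A₀ , λ v _ → component-is-tree v , at-most-one-degree-r v)
  (λ (low-degree-in-A₀ , forest) → Backward.percolates G r A₀ max-deg low-degree-in-A₀ forest)
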